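{- Let $\mathcal{S}$, $\mathcal{MM}_2$ and the map $\phi$ be as described in the context. (1) Let $w\in\mathcal{S}$ and $m=\phi(w)$. The number of marked red $\searrow$ steps plus the number of marked black $\rightarrow$ steps in $m$ equals the $x$-coordinate of the endpoint of $w$, and the number of marked red $\rightarrow$ steps plus the number of marked black $\searrow$ steps in $m$ equals the $y$-coordinate of the endpoint of $w$. (2) $\phi$ is a well-defined length-preserving map from $\mathcal{S}$ to $\mathcal{MM}_2$ (in particular, whenever the procedure requires finding an earlier step, such a step exists, and the output is a Motzkin path).
   Context: A quarter plane walk is a finite walk in $\mathbb{Z}^2$ starting at $(0,0)$, staying in $\{(i,j): i\ge 0, j\ge 0\}$, using steps from a given set; its length is its number of steps. $\mathcal{S}$ is the class of quarter plane walks with steps from $\{(1,0),(1,-1),(0,-1),(-1,0),(-1,1),(0,1)\}$, written $\rightarrow,\searrow,\downarrow,\leftarrow,\nwarrow,\uparrow$ respectively. A Motzkin path is a walk from $(0,0)$ using the steps $\nearrow=(1,1)$, $\rightarrow=(1,0)$, $\searrow=(1,-1)$, never going below the $x$-axis and ending on the $x$-axis. $\mathcal{MM}_2$ is the class of Motzkin paths in which each step is coloured red or black and is additionally either marked or unmarked. The map $\phi$: given $w\in\mathcal{S}$, start with the empty path $m$ and read the steps of $w$ from first to last, modifying $m$ as follows. (1) Step $\uparrow$: append a marked red $\rightarrow$ to $m$. (2) Step $\rightarrow$: append a marked black $\rightarrow$ to $m$. (3) Step $\searrow$: find the rightmost step of $m$ that is either a marked red $\rightarrow$ or a marked black $\searrow$;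 if it is a marked red $\rightarrow$ replace it by an unmarked red $\nearrow$, if it is a marked black $\searrow$ replace it by an unmarked black $\rightarrow$. Then append a marked red $\searrow$. (4) Step $\nwarrow$: find the rightmost step of $m$ that is either a marked black $\rightarrow$ or a marked red $\searrow$; if it is a marked black $\rightarrow$ replace it by an unmarked black $\nearrow$, if it is a marked red $\searrow$ replace it by an unmarked red $\rightarrow$. Then append a marked black $\searrow$. (5) Step $\leftarrow$: perform the same search and replacement as in (4), then append an unmarked red $\searrow$. (6) Step $\downarrow$: perform the same search and replacement as in (3), then append an unmarked black $\searrow$. The final $m$ is $\phi(w)$. -}

module Defs where

open import Data.Nat using (ℕ; zero; suc)
open import Data.Integer using (ℤ; +_; _+_; _-_; _≤_)
open import Data.Bool using (Bool; true; false; if_then_else_)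
open import Data.List using (List; []; _∷_; _++_; [_]; take; foldl; length)
open import Data.Maybe using (Maybe; just; nothing)
open import Data.Product using (_×_; _,_; proj₁; proj₂)
open import Relation.Binary.PropositionalEquality using (_≡_)

data Step : Set where
  E SE S W NW N : Step

δ : Step → ℤ × ℤ
δ E  = (+ 1 , + 0)
δ SE = (+ 1 , Data.Integer.-[1+ 0 ])
δ S  = (+ 0 , Data.Integer.-[1+ 0 ])
δ W  = (Data.Integer.-[1+ 0 ] , + 0)
δ NW = (Data.Integer.-[1+ 0 ] , + 1)
δ N  = (+ 0 , + 1)

endpoint : List Step → ℤ × ℤ
endpoint = foldl (λ p s → (proj₁ p + proj₁ (δ s) , proj₂ p + proj₂ (δ s))) (+ 0 , + 0)

InQuarterPlane : List Step → Set
InQuarterPlane w = ∀ (k : ℕ) → (+ 0 ≤ proj₁ (endpoint (take k w))) × (+ 0 ≤ proj₂ (endpoint (take k w)))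

data Shape : Set where
  up flat down : Shape

data Colour : Set where
  red black : Colour

record MStep : Set where
  constructor mstep
  field
    shape  : Shape
    colour : Colour
    marked : Bool
open MStep public

height : List MStep → ℤ
height = foldl (λ h s → h + Δ (shape s)) (+ 0)
  where
  Δ : Shape → ℤ
  Δ up   = + 1
  Δ flat = + 0
  Δ down = Data.Integer.-[1+ 0 ]

IsMotzkin : List MStep → Set
IsMotzkin m = (∀ (k : ℕ) → + 0 ≤ height (take k m)) × (height m ≡ + 0)

-- The map φ (partial: a search may fail, giving nothing)

replaceRightmost : (MStep → Maybe MStep) → List MStep → Maybe (List MStep)
replaceRightmost f [] = nothing
replaceRightmost f (x ∷ xs) with replaceRightmost f xs
... | just ys = just (x ∷ ys)
... | nothing with f x
...   | just y  = just (y ∷ xs)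
...   | nothing = nothing

-- search/replace of rule (3) (also used in (6)):
-- marked red → ↦ unmarked red ↗ ; marked black ↘ ↦ unmarked black →
replA : MStep → Maybe MStep
replA (mstep flat red true)   = just (mstep up red false)
replA (mstep down black true) = just (mstep flat black false)
replA _ = nothing

-- search/replace of rule (4) (also used in (5)):
-- marked black → ↦ unmarked black ↗ ; marked red ↘ ↦ unmarked red →
replB : MStep → Maybe MStep
replB (mstep flat black true) = just (mstep up black false)
replB (mstep down red true)   = just (mstep flat red false)
replB _ = nothing

appendAfter : (MStep → Maybe MStep) → MStep → List MStep → Maybe (List MStep)
appendAfter f s m with replaceRightmost f m
... | just m' = just (m' ++ [ s ])
... | nothing = nothing

φstep : Step → List MStep → Maybe (List MStep)
φstep N  m = just (m ++ [ mstep flat red true ])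
φstep E  m = just (m ++ [ mstep flat black true ])
φstep SE m = appendAfter replA (mstep down red true) m
φstep NW m = appendAfter replB (mstep down black true) m
φstep W  m = appendAfter replB (mstep down red false) m
φstep S  m = appendAfter replA (mstep down black false) m

φ-from : List MStep → List Step → Maybe (List MStep)
φ-from m [] = just m
φ-from m (s ∷ w) with φstep s m
... | just m' = φ-from m' w
... | nothing = nothing

φ : List Step → Maybe (List MStep)
φ = φ-from []

count : (MStep → Bool) → List MStep → ℕ
count p [] = 0
count p (x ∷ xs) = if p x then suc (count p xs) else count p xs

isXStep : MStep → Bool
isXStep (mstep down red true)   = true
isXStep (mstep flat black true) = true
isXStep _ = false

isYStep : MStep → Bool
isYStep (mstep flat red true)   = true
isYStep (mstep down black true) = true
isYStep _ = false

-- Along the walk, the partial output m of φ has nonnegative prefix heights and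
-- height 0, and its x-steps (marked red ↘, marked black →) and y-steps (marked
-- red →, marked black ↘) number exactly the coordinates of the current point.
-- A step that decreases a coordinate stays in the quarter plane, so that
-- coordinate was positive and rules (3)/(4) find a step to replace; replacing
-- it unmarks it and raises its slope by one, lifting every later prefix, and
-- the appended ↘ brings the height back to 0.
module Submission where

open import Defs
open import Data.Nat using (ℕ; zero; suc; _<_; z≤n; s≤s)
import Data.Nat as ℕ
import Data.Nat.Properties as ℕ
open import Data.Integer using (ℤ; +_; -[1+_]; _+_; _≤_)
import Data.Integer.Properties as ℤ
open import Algebra.Properties.CommutativeSemigroup ℤ.+-commutativeSemigroup
  using (x∙yz≈y∙xz)
open import Data.List using (List; []; _∷_; [_]; _∷ʳ_; length; take; foldl)
open import Data.List.Properties using (foldl-∷ʳ; length-++)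
open import Data.Maybe using (Maybe; just; nothing)
open import Data.Bool using (Bool; true; false)
open import Data.Empty using (⊥-elim)
open import Data.Sum using (_⊎_; inj₁; inj₂)
open import Data.Product using (Σ; _×_; _,_; proj₁; proj₂)
open import Relation.Binary.PropositionalEquality
  using (_≡_; refl; sym; trans; cong; cong₂; subst; subst₂; module ≡-Reasoning)

open ≡-Reasoning

slope : Shape → ℤ
slope up   = + 1
slope flat = + 0
slope down = -[1+ 0 ]

foldl-+-shift : ∀ {A : Set} (d : A → ℤ) h xs →
  foldl (λ i a → i + d a) h xs ≡ h + foldl (λ i a → i + d a) (+ 0) xs
foldl-+-shift d h [] = sym (ℤ.+-identityʳ h)
foldl-+-shift d h (x ∷ xs) = begin
  foldl _ (h + d x) xs          ≡⟨ foldl-+-shift d (h + d x) xs ⟩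
  h + d x + foldl _ (+ 0) xs    ≡⟨ ℤ.+-assoc h (d x) _ ⟩
  h + (d x + foldl _ (+ 0) xs)  ≡⟨ cong (λ i → h + i) (sym (foldl-+-shift d (d x) xs)) ⟩
  h + foldl _ (d x) xs          ≡⟨ cong (λ i → h + foldl _ i xs) (sym (ℤ.+-identityˡ (d x))) ⟩
  h + foldl _ (+ 0 + d x) xs    ∎

height-∷ : ∀ x xs → height (x ∷ xs) ≡ slope (shape x) + height xs
height-∷ (mstep up   _ _) xs = foldl-+-shift _ (+ 1) xs
height-∷ (mstep flat _ _) xs = foldl-+-shift _ (+ 0) xs
height-∷ (mstep down _ _) xs = foldl-+-shift _ -[1+ 0 ] xs

height-∷ʳ : ∀ xs x → height (xs ∷ʳ x) ≡ height xs + slope (shape x)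
height-∷ʳ xs (mstep up   _ _) = foldl-∷ʳ _ (+ 0) _ xs
height-∷ʳ xs (mstep flat _ _) = foldl-∷ʳ _ (+ 0) _ xs
height-∷ʳ xs (mstep down _ _) = foldl-∷ʳ _ (+ 0) _ xs

count-∷-true : ∀ {p x} xs → p x ≡ true → count p (x ∷ xs) ≡ suc (count p xs)
count-∷-true xs px rewrite px = refl

count-∷-false : ∀ {p x} xs → p x ≡ false → count p (x ∷ xs) ≡ count p xs
count-∷-false xs px rewrite px = refl

count-∷ʳ : ∀ p xs x → count p (xs ∷ʳ x) ≡ count p xs ℕ.+ count p [ x ]
count-∷ʳ p []       x = refl
count-∷ʳ p (y ∷ xs) x with p y
... | true  = cong suc (count-∷ʳ p xs x)
... | false = count-∷ʳ p xs x

take-∷ʳ : ∀ {A : Set} k (xs : List A) x →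
  take k (xs ∷ʳ x) ≡ take k xs ⊎ take k (xs ∷ʳ x) ≡ xs ∷ʳ x
take-∷ʳ zero          xs       x = inj₁ refl
take-∷ʳ (suc zero)    []       x = inj₂ refl
take-∷ʳ (suc (suc k)) []       x = inj₂ refl
take-∷ʳ (suc k)       (y ∷ xs) x with take-∷ʳ k xs x
... | inj₁ eq = inj₁ (cong (y ∷_) eq)
... | inj₂ eq = inj₂ (cong (y ∷_) eq)

length-∷ʳ : ∀ {A : Set} (xs : List A) x → length (xs ∷ʳ x) ≡ suc (length xs)
length-∷ʳ xs x = trans (length-++ xs) (ℕ.+-comm (length xs) 1)

NonNegPrefixes : List MStep → Set
NonNegPrefixes m = ∀ k → + 0 ≤ height (take k m)

nonNegPrefixes-∷ʳ : ∀ {m} x → NonNegPrefixes m → + 0 ≤ height (m ∷ʳ x) →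
  NonNegPrefixes (m ∷ʳ x)
nonNegPrefixes-∷ʳ {m} x prefixes 0≤end k with take-∷ʳ k m x
... | inj₁ eq = subst (λ p → + 0 ≤ height p) (sym eq) (prefixes k)
... | inj₂ eq = subst (λ p → + 0 ≤ height p) (sym eq) 0≤end

isMotzkin-[] : IsMotzkin []
isMotzkin-[] = (λ { zero → ℤ.≤-refl ; (suc k) → ℤ.≤-refl }) , refl

isMotzkin-∷ʳ-flat : ∀ {m} c b → IsMotzkin m → IsMotzkin (m ∷ʳ mstep flat c b)
isMotzkin-∷ʳ-flat {m} c b (prefixes , end) =
  nonNegPrefixes-∷ʳ _ prefixes (ℤ.≤-reflexive (sym end′)) , end′
  where
  end′ : height (m ∷ʳ mstep flat c b) ≡ + 0
  end′ = trans (height-∷ʳ m _) (trans (ℤ.+-identityʳ (height m)) end)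

isMotzkin-∷ʳ-down : ∀ {m} c b → NonNegPrefixes m → height m ≡ + 1 →
  IsMotzkin (m ∷ʳ mstep down c b)
isMotzkin-∷ʳ-down {m} c b prefixes end =
  nonNegPrefixes-∷ʳ _ prefixes (ℤ.≤-reflexive (sym end′)) , end′
  where
  end′ : height (m ∷ʳ mstep down c b) ≡ + 0
  end′ = trans (height-∷ʳ m _) (cong (_+ -[1+ 0 ]) end)

data Replacement (f : MStep → Maybe MStep) (P Q : MStep → Bool) : MStep → Set where
  skipped : ∀ {x} → P x ≡ false → f x ≡ nothing → Replacement f P Q x
  raised  : ∀ {x y} → P x ≡ true → f x ≡ just y → P y ≡ false → Q y ≡ Q x →
            slope (shape y) ≡ + 1 + slope (shape x) → Replacement f P Q x

replA-replacement : ∀ x → Replacement replA isYStep isXStep x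
replA-replacement (mstep up   _     _)     = skipped refl refl
replA-replacement (mstep flat red   true)  = raised refl refl refl refl refl
replA-replacement (mstep flat red   false) = skipped refl refl
replA-replacement (mstep flat black _)     = skipped refl refl
replA-replacement (mstep down red   _)     = skipped refl refl
replA-replacement (mstep down black true)  = raised refl refl refl refl refl
replA-replacement (mstep down black false) = skipped refl refl

replB-replacement : ∀ x → Replacement replB isXStep isYStep x
replB-replacement (mstep up   _     _)     = skipped refl refl
replB-replacement (mstep flat black true)  = raised refl refl refl refl refl
replB-replacement (mstep flat black false) = skipped refl refl
replB-replacement (mstep flat red   _)     = skipped refl refl
replB-replacement (mstep down black _)     = skipped refl refl
replB-replacement (mstep down red   true)  = raised refl refl refl refl refl
replB-replacement (mstep down red   false) = skipped refl refl

module RaiseRightmost {f : MStep → Maybe MStep} {P Q : MStep → Bool}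
  (replacement : ∀ x → Replacement f P Q x) where

  replaceRightmost-fails : ∀ m → count P m ≡ 0 → replaceRightmost f m ≡ nothing
  replaceRightmost-fails []       _ = refl
  replaceRightmost-fails (x ∷ xs) none with replacement x
  ... | raised Px _ _ _ _ = ⊥-elim (ℕ.1+n≢0 (trans (sym (count-∷-true xs Px)) none))
  ... | skipped Px fx rewrite Px | replaceRightmost-fails xs none | fx = refl

  record Raised (m : List MStep) : Set where
    field
      result          : List MStep
      replaces        : replaceRightmost f m ≡ just result
      count-P         : count P m ≡ suc (count P result)
      count-Q         : count Q result ≡ count Q m
      length-result   : length result ≡ length m
      height-result   : height result ≡ + 1 + height m
      prefixes-raised : ∀ k → height (take k m) ≤ height (take k result)

  raised-∷ : ∀ x {m} → Raised m → Raised (x ∷ m)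
  raised-∷ x {m} R = record
    { result          = x ∷ result
    ; replaces        = replaces′
    ; count-P         = count-P′
    ; count-Q         = count-Q′
    ; length-result   = cong suc length-result
    ; height-result   = height-result′
    ; prefixes-raised = prefixes-raised′
    }
    where
    open Raised R
    replaces′ : replaceRightmost f (x ∷ m) ≡ just (x ∷ result)
    replaces′ rewrite replaces = refl
    count-P′ : count P (x ∷ m) ≡ suc (count P (x ∷ result))
    count-P′ with P x
    ... | true  = cong suc count-P
    ... | false = count-P
    count-Q′ : count Q (x ∷ result) ≡ count Q (x ∷ m)
    count-Q′ with Q x
    ... | true  = cong suc count-Q
    ... | false = count-Q
    height-result′ : height (x ∷ result) ≡ + 1 + height (x ∷ m)
    height-result′ = begin
      height (x ∷ result)                ≡⟨ height-∷ x result ⟩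
      slope (shape x) + height result    ≡⟨ cong (λ h → slope (shape x) + h) height-result ⟩
      slope (shape x) + (+ 1 + height m) ≡⟨ x∙yz≈y∙xz (slope (shape x)) (+ 1) (height m) ⟩
      + 1 + (slope (shape x) + height m) ≡⟨ cong (λ h → + 1 + h) (sym (height-∷ x m)) ⟩
      + 1 + height (x ∷ m)               ∎
    prefixes-raised′ : ∀ k → height (take k (x ∷ m)) ≤ height (take k (x ∷ result))
    prefixes-raised′ zero    = ℤ.≤-refl
    prefixes-raised′ (suc k) =
      subst₂ _≤_ (sym (height-∷ x (take k m))) (sym (height-∷ x (take k result)))
        (ℤ.+-monoʳ-≤ (slope (shape x)) (prefixes-raised k))

  raised-here : ∀ {x y} m → P x ≡ true → f x ≡ just y → P y ≡ false → Q y ≡ Q x →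
    slope (shape y) ≡ + 1 + slope (shape x) → count P m ≡ 0 → Raised (x ∷ m)
  raised-here {x} {y} m Px fx Py Qy slope-y none = record
    { result          = y ∷ m
    ; replaces        = replaces
    ; count-P         = count-P
    ; count-Q         = count-Q
    ; length-result   = refl
    ; height-result   = height-y∷ m
    ; prefixes-raised = prefixes-raised
    }
    where
    replaces : replaceRightmost f (x ∷ m) ≡ just (y ∷ m)
    replaces rewrite replaceRightmost-fails m none | fx = refl
    count-P : count P (x ∷ m) ≡ suc (count P (y ∷ m))
    count-P rewrite Px | Py = refl
    count-Q : count Q (y ∷ m) ≡ count Q (x ∷ m)
    count-Q rewrite Qy = refl
    height-y∷ : ∀ xs → height (y ∷ xs) ≡ + 1 + height (x ∷ xs)
    height-y∷ xs = begin
      height (y ∷ xs)                     ≡⟨ height-∷ y xs ⟩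
      slope (shape y) + height xs         ≡⟨ cong (_+ height xs) slope-y ⟩
      + 1 + slope (shape x) + height xs   ≡⟨ ℤ.+-assoc (+ 1) (slope (shape x)) (height xs) ⟩
      + 1 + (slope (shape x) + height xs) ≡⟨ cong (λ h → + 1 + h) (sym (height-∷ x xs)) ⟩
      + 1 + height (x ∷ xs)               ∎
    prefixes-raised : ∀ k → height (take k (x ∷ m)) ≤ height (take k (y ∷ m))
    prefixes-raised zero    = ℤ.≤-refl
    prefixes-raised (suc k) =
      subst (height (x ∷ take k m) ≤_) (sym (height-y∷ (take k m))) (ℤ.i≤j+i _ (+ 1))

  raiseRightmost : ∀ m → 0 < count P m → Raised m
  raiseRightmost (x ∷ xs) 0<count with replacement x
  ... | skipped Px _ = raised-∷ x (raiseRightmost xs (subst (0 <_) (count-∷-false xs Px) 0<count))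
  ... | raised Px fx Py Qy slope-y with count P xs in count-xs
  ...   | zero  = raised-here xs Px fx Py Qy slope-y count-xs
  ...   | suc _ = raised-∷ x (raiseRightmost xs (subst (0 <_) (sym count-xs) (s≤s z≤n)))

  appendAfter-down : ∀ {m} c b → let s = mstep down c b in
    IsMotzkin m → 0 < count P m → P s ≡ false →
    Σ (List MStep) λ m′ → (appendAfter f s m ≡ just m′)
      × (+ count P m′ ≡ + count P m + -[1+ 0 ])
      × (+ count Q m′ ≡ + count Q m + + count Q [ s ])
      × IsMotzkin m′ × (length m′ ≡ suc (length m))
  appendAfter-down {m} c b (prefixes , end) 0<count Ps =
    result ∷ʳ s , computed , count-P′ , count-Q′ , motzkin , length-result′
    where
    s = mstep down c b
    open Raised (raiseRightmost m 0<count)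
    computed : appendAfter f s m ≡ just (result ∷ʳ s)
    computed rewrite replaces = refl
    count-P′ : + count P (result ∷ʳ s) ≡ + count P m + -[1+ 0 ]
    count-P′ rewrite count-P | count-∷ʳ P result s | Ps = cong +_ (ℕ.+-identityʳ _)
    count-Q′ : + count Q (result ∷ʳ s) ≡ + count Q m + + count Q [ s ]
    count-Q′ rewrite count-∷ʳ Q result s | count-Q = refl
    motzkin : IsMotzkin (result ∷ʳ s)
    motzkin = isMotzkin-∷ʳ-down c b (λ k → ℤ.≤-trans (prefixes k) (prefixes-raised k))
      (trans height-result (cong (λ h → + 1 + h) end))
    length-result′ : length (result ∷ʳ s) ≡ suc (length m)
    length-result′ = trans (length-∷ʳ result s) (cong suc length-result)

module ReplA = RaiseRightmost replA-replacement
module ReplB = RaiseRightmost replB-replacement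

counts : List MStep → ℤ × ℤ
counts m = (+ count isXStep m , + count isYStep m)

move : ℤ × ℤ → Step → ℤ × ℤ
move p s = (proj₁ p + proj₁ (δ s) , proj₂ p + proj₂ (δ s))

InQuadrant : ℤ × ℤ → Set
InQuadrant p = (+ 0 ≤ proj₁ p) × (+ 0 ≤ proj₂ p)

0≤n-1⇒0<n : ∀ {n} → + 0 ≤ + n + -[1+ 0 ] → 0 < n
0≤n-1⇒0<n {suc n} _ = s≤s z≤n

record Output (r : Maybe (List MStep)) (p : ℤ × ℤ) (ℓ : ℕ) : Set where
  constructor output
  field
    path        : List MStep
    computed    : r ≡ just path
    counts-path : counts path ≡ p
    motzkin     : IsMotzkin path
    length-path : length path ≡ ℓ

φstep-output : ∀ s m → IsMotzkin m → InQuadrant (move (counts m) s) →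
  Output (φstep s m) (move (counts m) s) (suc (length m))
φstep-output N m M _ =
  output (m ∷ʳ mstep flat red true) refl
    (cong₂ _,_ (cong +_ (count-∷ʳ isXStep m _)) (cong +_ (count-∷ʳ isYStep m _)))
    (isMotzkin-∷ʳ-flat red true M) (length-∷ʳ m _)
φstep-output E m M _ =
  output (m ∷ʳ mstep flat black true) refl
    (cong₂ _,_ (cong +_ (count-∷ʳ isXStep m _)) (cong +_ (count-∷ʳ isYStep m _)))
    (isMotzkin-∷ʳ-flat black true M) (length-∷ʳ m _)
φstep-output SE m M (_ , 0≤y) with ReplA.appendAfter-down red true M (0≤n-1⇒0<n 0≤y) refl
... | m′ , computed , count-y , count-x , M′ , len =
  output m′ computed (cong₂ _,_ count-x count-y) M′ len
φstep-output S m M (_ , 0≤y) with ReplA.appendAfter-down black false M (0≤n-1⇒0<n 0≤y) refl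
... | m′ , computed , count-y , count-x , M′ , len =
  output m′ computed (cong₂ _,_ count-x count-y) M′ len
φstep-output NW m M (0≤x , _) with ReplB.appendAfter-down black true M (0≤n-1⇒0<n 0≤x) refl
... | m′ , computed , count-x , count-y , M′ , len =
  output m′ computed (cong₂ _,_ count-x count-y) M′ len
φstep-output W m M (0≤x , _) with ReplB.appendAfter-down red false M (0≤n-1⇒0<n 0≤x) refl
... | m′ , computed , count-x , count-y , M′ , len =
  output m′ computed (cong₂ _,_ count-x count-y) M′ len

φ-from-output : ∀ w m → IsMotzkin m →
  (∀ k → InQuadrant (foldl move (counts m) (take k w))) →
  Output (φ-from m w) (foldl move (counts m) w) (length m ℕ.+ length w)
φ-from-output []      m M _ = output m refl refl M (sym (ℕ.+-identityʳ (length m)))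
φ-from-output (s ∷ w) m M inQuadrant with φstep-output s m M (inQuadrant 1)
... | output m′ φstep-m m′-counts m′-motzkin m′-length rewrite φstep-m =
  output path computed (trans counts-path (cong (λ p → foldl move p w) m′-counts))
    motzkin length′
  where
  inQuadrant′ : ∀ k → InQuadrant (foldl move (counts m′) (take k w))
  inQuadrant′ k =
    subst (λ p → InQuadrant (foldl move p (take k w))) (sym m′-counts) (inQuadrant (suc k))
  open Output (φ-from-output w m′ m′-motzkin inQuadrant′)
  length′ : length path ≡ length m ℕ.+ suc (length w)
  length′ = begin
    length path                 ≡⟨ length-path ⟩
    length m′ ℕ.+ length w      ≡⟨ cong (ℕ._+ length w) m′-length ⟩
    suc (length m ℕ.+ length w) ≡⟨ ℕ.+-suc (length m) (length w) ⟨
    length m ℕ.+ suc (length w) ∎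

mainTheorem3 : (w : List Step) → InQuarterPlane w →
    Σ (List MStep) λ m →
      (φ w ≡ just m)
      × ((+ count isXStep m ≡ proj₁ (endpoint w)) × (+ count isYStep m ≡ proj₂ (endpoint w)))
      × (IsMotzkin m × (length m ≡ length w))
mainTheorem3 w inQuarterPlane =
  path , computed , (cong proj₁ counts-path , cong proj₂ counts-path) , motzkin , length-path
  where open Output (φ-from-output w [] isMotzkin-[] inQuarterPlane)
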